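{- Let $\mathcal{Q}=(Q,\rho)$ be a quasimetric space with betweenness $\mathcal{B}$, and let $x,y,z\in Q$ be such that $x\notin\overrightarrow{yz}$ and $y\notin\overrightarrow{zx}$. If $x\in\overrightarrow{zy}$, or $y\in\overrightarrow{xz}$, or $z\in\overrightarrow{xy}$, then $\mathcal{B}(\{x,y,z\})=\{xzy\}$. Otherwise, $\mathcal{B}(\{x,y,z\})=\emptyset$.
   Context: A quasimetric space is a pair $(Q,\rho)$ where $Q$ is a set and $\rho:Q\times Q\to[0,\infty)$ satisfies $\rho(x,y)=0\iff x=y$ and $\rho(x,y)\le \rho(x,z)+\rho(z,y)$ for all $x,y,z\in Q$ ($\rho$ need not be symmetric). For $a,b\in Q$ let $[ab]=\{c\in Q:\rho(a,b)=\rho(a,c)+\rho(c,b)\}$. For distinct $a,b\in Q$, the line $\overrightarrow{ab}=\{c\in Q: a\in[cb]\ \text{or}\ c\in[ab]\ \text{or}\ b\in[ac]\}$. The betweenness $\mathcal{B}$ is the set of ordered triples $(a,b,c)$ of pairwise distinct points with $\rho(a,b)+\rho(b,c)=\rho(a,c)$, written $abc$. For $S\subseteq Q$, $\mathcal{B}(S)=\{abc\in\mathcal{B}: a,b,c\in S\}$. -}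

module Defs where

open import Level using (0ℓ)
open import Data.Product using (Σ; ∃; _×_; _,_)
open import Data.Sum using (_⊎_)
open import Relation.Nullary using (¬_)
open import Relation.Binary.PropositionalEquality using (_≡_)
open import Relation.Binary.Structures using (IsTotalOrder)
open import Algebra.Structures using (IsCommutativeRing)
open import Function.Bundles using (_⇔_)

-- An abstract model of the real numbers: a Dedekind-complete ordered field
-- (all such models are isomorphic to ℝ).  The standard library has no reals.
record Reals : Set₁ where
  infixl 6 _+_
  infixl 7 _*_
  infix 4 _≤_
  field
    ℝ       : Set
    _+_ _*_ : ℝ → ℝ → ℝ
    -_      : ℝ → ℝ
    0ℝ 1ℝ   : ℝ
    _≤_     : ℝ → ℝ → Set
    isCommutativeRing : IsCommutativeRing _≡_ _+_ _*_ -_ 0ℝ 1ℝ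
    0≢1     : ¬ (0ℝ ≡ 1ℝ)
    *-inverse : ∀ x → ¬ (x ≡ 0ℝ) → ∃ λ y → x * y ≡ 1ℝ
    isTotalOrder : IsTotalOrder _≡_ _≤_
    +-monoˡ-≤ : ∀ {x y} z → x ≤ y → x + z ≤ y + z
    *-nonneg  : ∀ {x y} → 0ℝ ≤ x → 0ℝ ≤ y → 0ℝ ≤ x * y
    sup : (S : ℝ → Set) → (∃ λ s → S s) → (∃ λ b → ∀ s → S s → s ≤ b) →
          ∃ λ u → (∀ s → S s → s ≤ u) × (∀ b → (∀ s → S s → s ≤ b) → u ≤ b)

record Quasimetric (R : Reals) (Q : Set) : Set where
  open Reals R
  field
    ρ          : Q → Q → ℝ
    ρ-nonneg   : ∀ x y → 0ℝ ≤ ρ x y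
    ρ-zero     : ∀ x y → (ρ x y ≡ 0ℝ) ⇔ (x ≡ y)
    ρ-triangle : ∀ x y z → ρ x y ≤ ρ x z + ρ z y

module QuasimetricNotions {R : Reals} {Q : Set} (𝒬 : Quasimetric R Q) where
  open Reals R
  open Quasimetric 𝒬

  _∈[_,_] : Q → Q → Q → Set
  c ∈[ a , b ] = ρ a b ≡ ρ a c + ρ c b

  _∈line_,_ : Q → Q → Q → Set
  c ∈line a , b = (a ∈[ c , b ]) ⊎ (c ∈[ a , b ]) ⊎ (b ∈[ a , c ])

  Betw : Q → Q → Q → Set
  Betw a b c = ¬ (a ≡ b) × ¬ (b ≡ c) × ¬ (a ≡ c) × (ρ a b + ρ b c ≡ ρ a c)

  BetwIn : (Q → Set) → Q → Q → Q → Set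
  BetwIn S a b c = S a × S b × S c × Betw a b c

｛_,_,_｝ : {Q : Set} → Q → Q → Q → Q → Set
｛ x , y , z ｝ a = (a ≡ x) ⊎ (a ≡ y) ⊎ (a ≡ z)

-- The two
-- hypotheses x ∉ line yz and y ∉ line zx rule out five of the six orderings
-- of {x, y, z} (and force the three points to be distinct, since a repeated
-- point would trivially put x on the line yz), leaving only xzy.  Each of the
-- three lines in the case distinction contains z ∈ [xy] as one of its
-- alternatives, and its other alternatives are among the excluded orderings,
-- so the case distinction is exactly whether z ∈ [xy].
module Submission where

open import Defs
open import Data.Product using (_×_; _,_)
open import Data.Sum using (_⊎_; inj₁; inj₂)
open import Data.Empty using (⊥-elim)
open import Relation.Nullary using (¬_)
open import Relation.Binary.PropositionalEquality using (_≡_; refl; sym; trans; cong)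
open import Function.Bundles using (_⇔_; mk⇔; Equivalence)
open import Algebra.Structures using (IsCommutativeRing)

module SegmentProperties {R : Reals} {Q : Set} (𝒬 : Quasimetric R Q) where
  open Reals R
  open Quasimetric 𝒬
  open QuasimetricNotions 𝒬
  open IsCommutativeRing isCommutativeRing using (+-identityˡ; +-identityʳ)

  ρ-refl : ∀ a → ρ a a ≡ 0ℝ
  ρ-refl a = Equivalence.from (ρ-zero a a) refl

  source∈[] : ∀ a b → a ∈[ a , b ]
  source∈[] a b = sym (trans (cong (_+ ρ a b) (ρ-refl a)) (+-identityˡ (ρ a b)))

  target∈[] : ∀ a b → b ∈[ a , b ]
  target∈[] a b = sym (trans (cong (ρ a b +_) (ρ-refl b)) (+-identityʳ (ρ a b)))

  Betw⇒∈[] : ∀ {a b c} → Betw a b c → b ∈[ a , c ]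
  Betw⇒∈[] (_ , _ , _ , e) = sym e

module OffBothLines {R : Reals} {Q : Set} (𝒬 : Quasimetric R Q) (x y z : Q)
  (x∉yz : ¬ (QuasimetricNotions._∈line_,_ 𝒬 x y z))
  (y∉zx : ¬ (QuasimetricNotions._∈line_,_ 𝒬 y z x)) where
  open QuasimetricNotions 𝒬
  open SegmentProperties 𝒬

  y∉[x,z] : ¬ (y ∈[ x , z ])
  y∉[x,z] e = x∉yz (inj₁ e)

  x∉[y,z] : ¬ (x ∈[ y , z ])
  x∉[y,z] e = x∉yz (inj₂ (inj₁ e))

  z∉[y,x] : ¬ (z ∈[ y , x ])
  z∉[y,x] e = x∉yz (inj₂ (inj₂ e))

  y∉[z,x] : ¬ (y ∈[ z , x ])
  y∉[z,x] e = y∉zx (inj₂ (inj₁ e))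

  x∉[z,y] : ¬ (x ∈[ z , y ])
  x∉[z,y] e = y∉zx (inj₂ (inj₂ e))

  x≢y : ¬ (x ≡ y)
  x≢y refl = x∉[y,z] (source∈[] x z)

  z≢x : ¬ (z ≡ x)
  z≢x refl = z∉[y,x] (target∈[] y z)

  z≢y : ¬ (z ≡ y)
  z≢y refl = z∉[y,x] (source∈[] z x)

  onSomeLine⇒z∈[x,y] : (x ∈line z , y) ⊎ (y ∈line x , z) ⊎ (z ∈line x , y) → z ∈[ x , y ]
  onSomeLine⇒z∈[x,y] (inj₁ (inj₁ e))                 = e
  onSomeLine⇒z∈[x,y] (inj₁ (inj₂ (inj₁ e)))          = ⊥-elim (x∉[z,y] e)
  onSomeLine⇒z∈[x,y] (inj₁ (inj₂ (inj₂ e)))          = ⊥-elim (y∉[z,x] e)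
  onSomeLine⇒z∈[x,y] (inj₂ (inj₁ (inj₁ e)))          = ⊥-elim (x∉[y,z] e)
  onSomeLine⇒z∈[x,y] (inj₂ (inj₁ (inj₂ (inj₁ e))))   = ⊥-elim (y∉[x,z] e)
  onSomeLine⇒z∈[x,y] (inj₂ (inj₁ (inj₂ (inj₂ e))))   = e
  onSomeLine⇒z∈[x,y] (inj₂ (inj₂ (inj₁ e)))          = ⊥-elim (x∉[z,y] e)
  onSomeLine⇒z∈[x,y] (inj₂ (inj₂ (inj₂ (inj₁ e))))   = e
  onSomeLine⇒z∈[x,y] (inj₂ (inj₂ (inj₂ (inj₂ e))))   = ⊥-elim (y∉[x,z] e)

  z∈[x,y]⇒BetwIn-xzy : z ∈[ x , y ] → BetwIn ｛ x , y , z ｝ x z y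
  z∈[x,y]⇒BetwIn-xzy e =
    inj₁ refl , inj₂ (inj₂ refl) , inj₂ (inj₁ refl) ,
    (λ x≡z → z≢x (sym x≡z)) , z≢y , x≢y , sym e

  BetwIn⇒xzy : ∀ {a b c} → BetwIn ｛ x , y , z ｝ a b c → (a ≡ x) × (b ≡ z) × (c ≡ y)
  BetwIn⇒xzy (inj₁ refl , inj₂ (inj₂ refl) , inj₂ (inj₁ refl) , _) = refl , refl , refl
  BetwIn⇒xzy (inj₁ refl , inj₂ (inj₁ refl) , inj₂ (inj₂ refl) , B) = ⊥-elim (y∉[x,z] (Betw⇒∈[] B))
  BetwIn⇒xzy (inj₂ (inj₁ refl) , inj₁ refl , inj₂ (inj₂ refl) , B) = ⊥-elim (x∉[y,z] (Betw⇒∈[] B))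
  BetwIn⇒xzy (inj₂ (inj₁ refl) , inj₂ (inj₂ refl) , inj₁ refl , B) = ⊥-elim (z∉[y,x] (Betw⇒∈[] B))
  BetwIn⇒xzy (inj₂ (inj₂ refl) , inj₂ (inj₁ refl) , inj₁ refl , B) = ⊥-elim (y∉[z,x] (Betw⇒∈[] B))
  BetwIn⇒xzy (inj₂ (inj₂ refl) , inj₁ refl , inj₂ (inj₁ refl) , B) = ⊥-elim (x∉[z,y] (Betw⇒∈[] B))
  BetwIn⇒xzy (inj₁ refl , inj₁ refl , _ , a≢a , _)                  = ⊥-elim (a≢a refl)
  BetwIn⇒xzy (inj₂ (inj₁ refl) , inj₂ (inj₁ refl) , _ , a≢a , _)    = ⊥-elim (a≢a refl)
  BetwIn⇒xzy (inj₂ (inj₂ refl) , inj₂ (inj₂ refl) , _ , a≢a , _)    = ⊥-elim (a≢a refl)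
  BetwIn⇒xzy (_ , inj₁ refl , inj₁ refl , _ , b≢b , _)              = ⊥-elim (b≢b refl)
  BetwIn⇒xzy (_ , inj₂ (inj₁ refl) , inj₂ (inj₁ refl) , _ , b≢b , _) = ⊥-elim (b≢b refl)
  BetwIn⇒xzy (_ , inj₂ (inj₂ refl) , inj₂ (inj₂ refl) , _ , b≢b , _) = ⊥-elim (b≢b refl)
  BetwIn⇒xzy (inj₁ refl , _ , inj₁ refl , _ , _ , a≢a , _)          = ⊥-elim (a≢a refl)
  BetwIn⇒xzy (inj₂ (inj₁ refl) , _ , inj₂ (inj₁ refl) , _ , _ , a≢a , _) = ⊥-elim (a≢a refl)
  BetwIn⇒xzy (inj₂ (inj₂ refl) , _ , inj₂ (inj₂ refl) , _ , _ , a≢a , _) = ⊥-elim (a≢a refl)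

  BetwIn⇒z∈[x,y] : ∀ {a b c} → BetwIn ｛ x , y , z ｝ a b c → z ∈[ x , y ]
  BetwIn⇒z∈[x,y] B@(_ , _ , _ , betw) with BetwIn⇒xzy B
  ... | refl , refl , refl = Betw⇒∈[] betw

mainTheorem4 : (R : Reals) (Q : Set) (𝒬 : Quasimetric R Q) (x y z : Q) →
    let open QuasimetricNotions 𝒬 in
    ¬ (x ∈line y , z) → ¬ (y ∈line z , x) →
    (((x ∈line z , y) ⊎ (y ∈line x , z) ⊎ (z ∈line x , y)) →
        ∀ a b c → BetwIn ｛ x , y , z ｝ a b c ⇔ ((a ≡ x) × (b ≡ z) × (c ≡ y)))
    × (¬ ((x ∈line z , y) ⊎ (y ∈line x , z) ⊎ (z ∈line x , y)) →
        ∀ a b c → ¬ BetwIn ｛ x , y , z ｝ a b c)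
mainTheorem4 R Q 𝒬 x y z x∉yz y∉zx = onSomeLine , onNoLine
  where
  open QuasimetricNotions 𝒬
  open OffBothLines 𝒬 x y z x∉yz y∉zx

  onSomeLine : (x ∈line z , y) ⊎ (y ∈line x , z) ⊎ (z ∈line x , y) →
    ∀ a b c → BetwIn ｛ x , y , z ｝ a b c ⇔ ((a ≡ x) × (b ≡ z) × (c ≡ y))
  onSomeLine onLine a b c = mk⇔ BetwIn⇒xzy λ where
    (refl , refl , refl) → z∈[x,y]⇒BetwIn-xzy (onSomeLine⇒z∈[x,y] onLine)

  onNoLine : ¬ ((x ∈line z , y) ⊎ (y ∈line x , z) ⊎ (z ∈line x , y)) →
    ∀ a b c → ¬ BetwIn ｛ x , y , z ｝ a b c
  onNoLine offLines a b c B = offLines (inj₁ (inj₁ (BetwIn⇒z∈[x,y] B)))
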